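{- For $n\geq 0$, $F_n^M(x,y,q)=F_n(x,y,q)$.
   Context: Permutations: $S_n(123,132,213)$ is the set of permutations of $[n]$ with no subsequence order isomorphic to $123$, $132$ or $213$; each such $\pi$ is a concatenation of increasing blocks of size $1$ or $2$, each block larger than all later blocks; $s(\pi)$, $d(\pi)$ are the numbers of maximal increasing runs of $\pi$ of length $1$ and $2$; $maj(\pi)=\sum_{i:\,p_i>p_{i+1}}i$; $F_n^M(x,y,q)=\sum_{\pi\in S_n(123,132,213)}x^{s(\pi)}y^{d(\pi)}q^{maj(\pi)}$. Set partitions: a partition of $[n]$ is written $B_1/B_2/\dots/B_k$ with $\min B_1<\dots<\min B_k$. For $\alpha=A_1/\dots/A_k\vdash[m]$ and $\beta=B_1/\dots/B_\ell\vdash[n]$, $\beta$ contains the pattern $\alpha$ if there are distinct blocks $B_{i_1},\dots,B_{i_k}$ of $\beta$ and subsets $A'_j\subseteq B_{i_j}$ such that the partition $A'_1/\dots/A'_k$ of $\bigcup_j A'_j$ is carried to $\alpha$ by the unique order-preserving bijection $\bigcup_j A'_j\to[m]$; otherwise $\beta$ avoids $\alpha$. $\Pi_n(13/2,123)$ is the set of partitions of $[n]$ avoiding both $13/2$ and $123$. For $\alpha=B_1/\dots/B_k$, a right bigger pair is a pair $(b,B_j)$ with $b\in B_i$, $j>i$ and $\max B_j>b$; $rb(\alpha)$ is the number of right bigger pairs. $s(\alpha)$, $d(\alpha)$ are the numbers of blocks of size $1$ and $2$. $F_n(x,y,q)=\sum_{\alpha\in\Pi_n(13/2,123)}x^{s(\alpha)}y^{d(\alpha)}q^{rb(\alpha)}$.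 -}

module Defs where

open import Data.Nat using (ℕ; zero; suc; _+_; _<_; _<ᵇ_; _≡ᵇ_; _⊔_)
open import Data.Bool using (Bool; true; false; if_then_else_)
open import Data.List using (List; []; _∷_; length; map; upTo; concat; foldr; lookup)
open import Data.List.Membership.Propositional using (_∈_)
open import Data.List.Relation.Binary.Permutation.Propositional using (_↭_)
open import Data.List.Relation.Binary.Pointwise using (Pointwise)
open import Data.List.Relation.Binary.Sublist.Propositional using (_⊆_)
open import Data.List.Relation.Unary.All using (All)
open import Data.List.Relation.Unary.Linked using (Linked)
open import Data.Fin using (Fin)
open import Data.Product using (Σ; _×_; ∃; ∃₂)
open import Data.Refinement using (Refinement)
open import Function.Bundles using (_⇔_)
open import Function.Definitions using (Injective)
open import Relation.Nullary using (¬_)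
open import Relation.Binary.PropositionalEquality using (_≡_)

countEq : ℕ → List ℕ → ℕ
countEq k [] = 0
countEq k (x ∷ xs) = (if x ≡ᵇ k then 1 else 0) + countEq k xs

range1 : ℕ → List ℕ
range1 n = map suc (upTo n)

IsPerm : ℕ → List ℕ → Set
IsPerm n π = π ↭ range1 n

-- order isomorphism of two sequences of distinct numbers:
-- for all positions i < j,  xᵢ < xⱼ  ⇔  yᵢ < yⱼ
data OrdIso : List ℕ → List ℕ → Set where
  []  : OrdIso [] []
  _∷_ : ∀ {x y xs ys} →
        Pointwise (λ a b → (x < a) ⇔ (y < b)) xs ys →
        OrdIso xs ys → OrdIso (x ∷ xs) (y ∷ ys)

PContains : List ℕ → List ℕ → Set
PContains π σ = ∃ λ τ → (τ ⊆ π) × OrdIso τ σ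

PAvoids : List ℕ → List ℕ → Set
PAvoids π σ = ¬ PContains π σ

p123 p132 p213 : List ℕ
p123 = 1 ∷ 2 ∷ 3 ∷ []
p132 = 1 ∷ 3 ∷ 2 ∷ []
p213 = 2 ∷ 1 ∷ 3 ∷ []

-- lengths of the maximal increasing runs of a sequence
runsFrom : ℕ → ℕ → List ℕ → List ℕ
runsFrom prev cur [] = cur ∷ []
runsFrom prev cur (y ∷ ys) =
  if prev <ᵇ y then runsFrom y (suc cur) ys else cur ∷ runsFrom y 1 ys

runLengths : List ℕ → List ℕ
runLengths [] = []
runLengths (x ∷ xs) = runsFrom x 1 xs

sPerm dPerm : List ℕ → ℕ
sPerm π = countEq 1 (runLengths π)
dPerm π = countEq 2 (runLengths π)

-- maj π = Σ { i : pᵢ > pᵢ₊₁ }, positions 1-based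
majFrom : ℕ → List ℕ → ℕ
majFrom i [] = 0
majFrom i (x ∷ []) = 0
majFrom i (x ∷ y ∷ ys) = (if y <ᵇ x then i else 0) + majFrom (suc i) (y ∷ ys)

maj : List ℕ → ℕ
maj π = majFrom 1 π

-- Set partitions B₁/B₂/…/Bₖ, each block a strictly increasing list,
-- blocks listed with min B₁ < min B₂ < … < min Bₖ

data MinLt : List ℕ → List ℕ → Set where
  minLt : ∀ {a b as bs} → a < b → MinLt (a ∷ as) (b ∷ bs)

data NonEmpty : List ℕ → Set where
  nonEmpty : ∀ {a as} → NonEmpty (a ∷ as)

IsSetPartition : ℕ → List (List ℕ) → Set
IsSetPartition n β =
  All NonEmpty β × All (Linked _<_) β × Linked MinLt β × (concat β ↭ range1 n)

-- β contains the pattern α (α a partition of [m]): there is an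
-- order-preserving injection f of the ground set of α into [n] and an
-- injective assignment g of blocks of α to blocks of β with f(Aⱼ) ⊆ B_{g j}
-- (so A'ⱼ = f(Aⱼ) are subsets of distinct blocks, carried to α by f⁻¹).
Contains : List (List ℕ) → List (List ℕ) → Set
Contains β α =
  Σ (ℕ → ℕ) λ f → Σ (Fin (length α) → Fin (length β)) λ g →
    (∀ a b → a ∈ concat α → b ∈ concat α → a < b → f a < f b) ×
    Injective _≡_ _≡_ g ×
    (∀ j a → a ∈ lookup α j → f a ∈ lookup β (g j))

Avoids : List (List ℕ) → List (List ℕ) → Set
Avoids β α = ¬ Contains β α

pat13/2 pat123 : List (List ℕ)
pat13/2 = (1 ∷ 3 ∷ []) ∷ (2 ∷ []) ∷ []
pat123 = (1 ∷ 2 ∷ 3 ∷ []) ∷ []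

blockSizes : List (List ℕ) → List ℕ
blockSizes β = map length β

sPart dPart : List (List ℕ) → ℕ
sPart β = countEq 1 (blockSizes β)
dPart β = countEq 2 (blockSizes β)

maxL : List ℕ → ℕ
maxL = foldr _⊔_ 0

countBelow : ℕ → List ℕ → ℕ
countBelow m [] = 0
countBelow m (b ∷ bs) = (if b <ᵇ m then 1 else 0) + countBelow m bs

-- number of right bigger pairs (b , C) with b ∈ B and C a later block
rbWith : List ℕ → List (List ℕ) → ℕ
rbWith B [] = 0
rbWith B (C ∷ Cs) = countBelow (maxL C) B + rbWith B Cs

rb : List (List ℕ) → ℕ
rb [] = 0
rb (B ∷ Bs) = rbWith B Bs + rb Bs

-- Coefficient classes of the two generating functions:
-- the coefficient of x^a y^b q^c in F_n^M resp. F_n is the cardinality of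

PermFiber : ℕ → ℕ → ℕ → ℕ → Set
PermFiber n a b c = Refinement (List ℕ) λ π →
  IsPerm n π × PAvoids π p123 × PAvoids π p132 × PAvoids π p213 ×
  sPerm π ≡ a × dPerm π ≡ b × maj π ≡ c

PartFiber : ℕ → ℕ → ℕ → ℕ → Set
PartFiber n a b c = Refinement (List (List ℕ)) λ β →
  IsSetPartition n β × Avoids β pat13/2 × Avoids β pat123 ×
  sPart β ≡ a × dPart β ≡ b × rb β ≡ c

-- A permutation avoiding 123, 132 and 213 is the
-- concatenation of increasing runs of length 1 or 2, each run consisting of
-- the largest values not used before it; a partition avoiding 13/2 and 123
-- consists of blocks that are intervals of length 1 or 2, in increasing order.
-- Either object is therefore determined by a composition of n into parts 1
-- and 2 (its run lengths, resp. block sizes), which also determines s and d.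
-- For the composition c₁ … cₖ both remaining statistics equal
-- Σᵢ cᵢ · (k − i): the descents of the permutation sit at the partial sums
-- c₁ + … + cᵢ (i < k), and every element of the i-th block of the partition
-- is below the maximum of each of the k − i later blocks.
module Submission where

open import Defs
open import Data.Bool using (true; false)
open import Data.Bool.Properties using (T-≡)
open import Data.Empty using (⊥; ⊥-elim)
open import Data.Fin using (Fin; zero; suc)
import Data.Fin.Properties as Finₚ
open import Data.Irrelevant using ([_])
open import Data.List
  using (List; []; _∷_; _++_; length; map; concat; lookup; applyUpTo; applyDownFrom)
open import Data.List.Properties using (≡-dec; map-upTo; reverse-applyUpTo)
open import Data.List.Membership.Propositional using (_∈_)
open import Data.List.Membership.Propositional.Properties
  using (∈-++⁻; ∈-concat⁻; ∈-applyDownFrom⁻; ∈-lookup)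
open import Data.List.Relation.Binary.Permutation.Propositional
  using (_↭_; prep; swap; ↭-refl; ↭-sym; ↭-trans; ↭-reflexive)
open import Data.List.Relation.Binary.Permutation.Propositional.Properties
  using (↭-empty-inv; ¬x∷xs↭[]; ∈-resp-↭; drop-∷; ↭-reverse)
open import Data.List.Relation.Binary.Pointwise using ([]; _∷_)
open import Data.List.Relation.Binary.Sublist.Propositional
  using (_⊆_; _∷_; _∷ʳ_; ⊆-refl; ⊆-trans; to∈; from∈)
open import Data.List.Relation.Unary.All using (All; []; _∷_)
import Data.List.Relation.Unary.All as All
open import Data.List.Relation.Unary.Any using (Any; here; there; index)
open import Data.List.Relation.Unary.Any.Properties using (lookup-index)
open import Data.List.Relation.Unary.Linked using (Linked; []; [-]; _∷_)
import Data.List.Relation.Unary.Linked as Linked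
open import Data.Nat
  using (ℕ; zero; suc; _+_; _*_; _<_; _≤_; _<ᵇ_; _≟_; z≤n; s≤s)
open import Data.Nat.Properties
open import Data.Nat.Tactic.RingSolver using (solve-∀)
open import Data.Product using (∃; ∃₂; _×_; _,_; proj₁; proj₂)
open import Data.Refinement using (Refinement; _,_; value-injective)
import Data.Refinement as Refinement
open import Data.Sum using (_⊎_; inj₁; inj₂)
open import Function using (_∘_; const)
open import Function.Bundles using (_⇔_; mk⇔; Equivalence; _↔_; mk↔ₛ′)
open import Relation.Binary.Definitions using (DecidableEquality)
open import Relation.Binary.PropositionalEquality
  using (_≡_; _≢_; refl; sym; trans; cong; cong₂)
open import Relation.Nullary using (¬_; contradiction)
open import Relation.Nullary.Decidable using (recompute)

<ᵇ-true : ∀ {m n} → m < n → (m <ᵇ n) ≡ true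
<ᵇ-true m<n = Equivalence.to T-≡ (<⇒<ᵇ m<n)

<ᵇ-false : ∀ {m n} → n ≤ m → (m <ᵇ n) ≡ false
<ᵇ-false {m} {n} n≤m with m <ᵇ n in eq
... | false = refl
... | true = contradiction (<ᵇ⇒< m n (Equivalence.from T-≡ eq)) (≤⇒≯ n≤m)

∈-tail : ∀ {x y : ℕ} {l} → x ∈ y ∷ l → x ≢ y → x ∈ l
∈-tail (here x≡y) x≢y = contradiction x≡y x≢y
∈-tail (there x∈l) _ = x∈l

ordered-pair : ∀ {a b : ℕ} {l} → a ∈ l → b ∈ l → a ≢ b →
               (a ∷ b ∷ [] ⊆ l) ⊎ (b ∷ a ∷ [] ⊆ l)
ordered-pair (here refl) (here refl) a≢b = contradiction refl a≢b
ordered-pair (here refl) (there b∈) _ = inj₁ (refl ∷ from∈ b∈)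
ordered-pair (there a∈) (here refl) _ = inj₂ (refl ∷ from∈ a∈)
ordered-pair (there a∈) (there b∈) a≢b with ordered-pair a∈ b∈ a≢b
... | inj₁ ab⊆ = inj₁ (_ ∷ʳ ab⊆)
... | inj₂ ba⊆ = inj₂ (_ ∷ʳ ba⊆)

second∈ : ∀ {a b : ℕ} {xs l} → a ∷ b ∷ xs ⊆ l → b ∈ l
second∈ s = to∈ (⊆-trans (_ ∷ʳ ⊆-refl) s)

1<2 : 1 < 2
1<2 = s≤s (s≤s z≤n)

1<3 : 1 < 3
1<3 = s≤s (s≤s z≤n)

2<3 : 2 < 3
2<3 = s≤s (s≤s (s≤s z≤n))

-- Compositions into parts 1 and 2

data Step : Set where
  one two : Step

size : Step → ℕ
size one = 1
size two = 2

total : List Step → ℕ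
total [] = 0
total (s ∷ κ) = size s + total κ

sizes : List Step → List ℕ
sizes = map size

-- Reads every entry other than 1 as a 2.
fromSizes : List ℕ → List Step
fromSizes [] = []
fromSizes (1 ∷ ks) = one ∷ fromSizes ks
fromSizes (_ ∷ ks) = two ∷ fromSizes ks

fromSizes-sizes : ∀ κ → fromSizes (sizes κ) ≡ κ
fromSizes-sizes [] = refl
fromSizes-sizes (one ∷ κ) = cong (one ∷_) (fromSizes-sizes κ)
fromSizes-sizes (two ∷ κ) = cong (two ∷_) (fromSizes-sizes κ)

laterPairs : List Step → ℕ
laterPairs [] = 0
laterPairs (s ∷ κ) = size s * length κ + laterPairs κ

-- The permutation of a composition

down : ℕ → List ℕ
down = applyDownFrom suc

down↭range1 : ∀ n → down n ↭ range1 n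
down↭range1 n =
  ↭-trans (↭-reflexive (sym (reverse-applyUpTo suc n)))
          (↭-trans (↭-reverse (applyUpTo suc n)) (↭-reflexive (sym (map-upTo suc n))))

∈-down⁻ : ∀ {x n} → x ∈ down n → x ≤ n
∈-down⁻ x∈ with _ , i<n , refl ← ∈-applyDownFrom⁻ suc x∈ = i<n

toPerm : List Step → List ℕ
toPerm [] = []
toPerm (one ∷ κ) = suc (total κ) ∷ toPerm κ
toPerm (two ∷ κ) = suc (total κ) ∷ suc (suc (total κ)) ∷ toPerm κ

toPerm-↭ : ∀ κ → toPerm κ ↭ down (total κ)
toPerm-↭ [] = ↭-refl
toPerm-↭ (one ∷ κ) = prep _ (toPerm-↭ κ)
toPerm-↭ (two ∷ κ) = swap _ _ (toPerm-↭ κ)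

toPerm-< : ∀ κ {x} → total κ < x → All (_< x) (toPerm κ)
toPerm-< [] _ = []
toPerm-< (one ∷ κ) κ<x = κ<x ∷ toPerm-< κ (<-trans (n<1+n _) κ<x)
toPerm-< (two ∷ κ) κ<x =
  <-trans (n<1+n _) κ<x ∷ κ<x ∷ toPerm-< κ (<-trans (n<1+n _) (<-trans (n<1+n _) κ<x))

runsFrom-toPerm : ∀ κ {p} k → total κ ≤ p → runsFrom p k (toPerm κ) ≡ k ∷ sizes κ
runsFrom-toPerm [] k _ = refl
runsFrom-toPerm (one ∷ κ) {p} k κ≤p rewrite <ᵇ-false {p} κ≤p =
  cong (k ∷_) (runsFrom-toPerm κ 1 (n≤1+n _))
runsFrom-toPerm (two ∷ κ) {p} k κ≤p
  rewrite <ᵇ-false {p} (≤-trans (n≤1+n _) κ≤p) | <ᵇ-true (n<1+n (suc (total κ))) =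
  cong (k ∷_) (runsFrom-toPerm κ 2 (m≤n⇒m≤1+n (n≤1+n _)))

runLengths-toPerm : ∀ κ → runLengths (toPerm κ) ≡ sizes κ
runLengths-toPerm [] = refl
runLengths-toPerm (one ∷ κ) = runsFrom-toPerm κ 1 (n≤1+n _)
runLengths-toPerm (two ∷ κ) rewrite <ᵇ-true (n<1+n (suc (total κ))) =
  runsFrom-toPerm κ 2 (m≤n⇒m≤1+n (n≤1+n _))

majFrom-descent : ∀ i {x} s κ → total (s ∷ κ) < x →
                  majFrom i (x ∷ toPerm (s ∷ κ)) ≡ i + majFrom (suc i) (toPerm (s ∷ κ))
majFrom-descent i one κ κ<x rewrite <ᵇ-true κ<x = refl
majFrom-descent i two κ κ<x rewrite <ᵇ-true (<-trans (n<1+n _) κ<x) = refl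

-- Starting the count at position suc m adds m for each of the length κ descents.
majFrom-toPerm : ∀ m s κ → majFrom (suc m) (toPerm (s ∷ κ)) ≡ m * length κ + laterPairs (s ∷ κ)
majFrom-toPerm m one [] rewrite *-zeroʳ m = refl
majFrom-toPerm m two [] rewrite *-zeroʳ m = refl
majFrom-toPerm m one (t ∷ κ)
  rewrite majFrom-descent (suc m) t κ ≤-refl | majFrom-toPerm (suc m) t κ =
  lemma m (length κ) (laterPairs (t ∷ κ))
  where
  lemma : ∀ m l h → suc m + (suc m * l + h) ≡ m * suc l + (suc l + 0 + h)
  lemma = solve-∀
majFrom-toPerm m two (t ∷ κ)
  rewrite <ᵇ-false {suc (suc (total (t ∷ κ)))} (n≤1+n (suc (total (t ∷ κ))))
        | majFrom-descent (suc (suc m)) t κ (m<n⇒m<1+n (n<1+n _))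
        | majFrom-toPerm (suc (suc m)) t κ =
  lemma m (length κ) (laterPairs (t ∷ κ))
  where
  lemma : ∀ m l h → suc (suc m) + (suc (suc m) * l + h) ≡ m * suc l + (suc (l + suc (l + 0)) + h)
  lemma = solve-∀

maj-toPerm : ∀ κ → maj (toPerm κ) ≡ laterPairs κ
maj-toPerm [] = refl
maj-toPerm (s ∷ κ) = majFrom-toPerm 0 s κ

data Layered : List ℕ → Set where
  []   : Layered []
  run₁ : ∀ {x l} → All (_< x) l → Layered l → Layered (x ∷ l)
  run₂ : ∀ {x y l} → x < y → All (_< x) l → Layered (y ∷ l) → Layered (x ∷ y ∷ l)

toPerm-layered : ∀ κ → Layered (toPerm κ)
toPerm-layered [] = []
toPerm-layered (one ∷ κ) = run₁ (toPerm-< κ ≤-refl) (toPerm-layered κ)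
toPerm-layered (two ∷ κ) =
  run₂ ≤-refl (toPerm-< κ ≤-refl) (run₁ (toPerm-< κ (m<n⇒m<1+n ≤-refl)) (toPerm-layered κ))

no-two-larger-after : ∀ {l a b d} → Layered l → a ∷ b ∷ d ∷ [] ⊆ l → a < b → a < d → ⊥
no-two-larger-after (run₁ _ l′) (_ ∷ʳ s) a<b a<d = no-two-larger-after l′ s a<b a<d
no-two-larger-after (run₂ _ _ l′) (_ ∷ʳ s) a<b a<d = no-two-larger-after l′ s a<b a<d
no-two-larger-after (run₁ below _) (refl ∷ s) a<b _ = <-asym a<b (All.lookup below (to∈ s))
no-two-larger-after (run₂ _ below _) (refl ∷ (_ ∷ʳ s)) a<b _ =
  <-asym a<b (All.lookup below (to∈ s))
no-two-larger-after (run₂ _ below _) (refl ∷ (refl ∷ s)) _ a<d =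
  <-asym a<d (All.lookup below (to∈ s))

no-two-smaller-before : ∀ {l a b d} → Layered l → a ∷ b ∷ d ∷ [] ⊆ l → a < d → b < d → ⊥
no-two-smaller-before (run₁ _ l′) (_ ∷ʳ s) a<d b<d = no-two-smaller-before l′ s a<d b<d
no-two-smaller-before (run₂ _ _ l′) (_ ∷ʳ s) a<d b<d = no-two-smaller-before l′ s a<d b<d
no-two-smaller-before (run₁ below _) (refl ∷ s) a<d _ =
  <-asym a<d (All.lookup below (second∈ s))
no-two-smaller-before (run₂ _ below _) (refl ∷ (_ ∷ʳ s)) a<d _ =
  <-asym a<d (All.lookup below (second∈ s))
no-two-smaller-before (run₂ _ below _) (refl ∷ (refl ∷ s)) a<d _ =
  <-asym a<d (All.lookup below (to∈ s))

Avoids₃ : List ℕ → Set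
Avoids₃ π = PAvoids π p123 × PAvoids π p132 × PAvoids π p213

toPerm-avoids : ∀ κ → Avoids₃ (toPerm κ)
toPerm-avoids κ = avoids123 , avoids132 , avoids213
  where
  avoids123 : PAvoids (toPerm κ) p123
  avoids123 (_ , s , (ab ∷ ad ∷ []) ∷ _) =
    no-two-larger-after (toPerm-layered κ) s (Equivalence.from ab 1<2) (Equivalence.from ad 1<3)
  avoids132 : PAvoids (toPerm κ) p132
  avoids132 (_ , s , (ab ∷ ad ∷ []) ∷ _) =
    no-two-larger-after (toPerm-layered κ) s (Equivalence.from ab 1<3) (Equivalence.from ad 1<2)
  avoids213 : PAvoids (toPerm κ) p213
  avoids213 (_ , s , (_ ∷ ad ∷ []) ∷ (bd ∷ []) ∷ _) =
    no-two-smaller-before (toPerm-layered κ) s (Equivalence.from ad 2<3) (Equivalence.from bd 1<3)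

⇔-true : ∀ {A B : Set} → A → B → A ⇔ B
⇔-true a b = mk⇔ (const b) (const a)

⇔-false : ∀ {A B : Set} → ¬ A → ¬ B → A ⇔ B
⇔-false ¬a ¬b = mk⇔ (⊥-elim ∘ ¬a) (⊥-elim ∘ ¬b)

ordIso₃ : ∀ {a b d p q r} → (a < b ⇔ p < q) → (a < d ⇔ p < r) → (b < d ⇔ q < r) →
          OrdIso (a ∷ b ∷ d ∷ []) (p ∷ q ∷ r ∷ [])
ordIso₃ ab ad bd = (ab ∷ ad ∷ []) ∷ (bd ∷ []) ∷ [] ∷ []

ordIso-123 : ∀ {a b d} → a < b → b < d → OrdIso (a ∷ b ∷ d ∷ []) p123
ordIso-123 a<b b<d = ordIso₃ (⇔-true a<b 1<2) (⇔-true (<-trans a<b b<d) 1<3) (⇔-true b<d 2<3)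

ordIso-132 : ∀ {a b d} → a < d → d < b → OrdIso (a ∷ b ∷ d ∷ []) p132
ordIso-132 a<d d<b =
  ordIso₃ (⇔-true (<-trans a<d d<b) 1<3) (⇔-true a<d 1<2) (⇔-false (<-asym d<b) (<-asym 2<3))

ordIso-213 : ∀ {a b d} → b < a → a < d → OrdIso (a ∷ b ∷ d ∷ []) p213
ordIso-213 b<a a<d =
  ordIso₃ (⇔-false (<-asym b<a) (<-asym 1<2)) (⇔-true a<d 2<3) (⇔-true (<-trans b<a a<d) 1<3)

avoids-tail : ∀ {x π σ} → PAvoids (x ∷ π) σ → PAvoids π σ
avoids-tail av (τ , s , iso) = av (τ , _ ∷ʳ s , iso)

avoids₃-tail : ∀ {x π} → Avoids₃ (x ∷ π) → Avoids₃ π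
avoids₃-tail (av123 , av132 , av213) = avoids-tail av123 , avoids-tail av132 , avoids-tail av213

two-larger-after : ∀ {x a b π} → Avoids₃ (x ∷ π) → x < a → a < b → a ∈ π → b ∈ π → ⊥
two-larger-after (av123 , av132 , _) x<a a<b a∈ b∈ with ordered-pair a∈ b∈ (<⇒≢ a<b)
... | inj₁ ab⊆ = av123 (_ , refl ∷ ab⊆ , ordIso-123 x<a a<b)
... | inj₂ ba⊆ = av132 (_ , refl ∷ ba⊆ , ordIso-132 x<a a<b)

smaller-then-larger : ∀ {x y z π} → Avoids₃ (x ∷ y ∷ π) → y < x → x < z → z ∈ π → ⊥
smaller-then-larger (_ , _ , av213) y<x x<z z∈ =
  av213 (_ , refl ∷ refl ∷ from∈ z∈ , ordIso-213 y<x x<z)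

second-is-top : ∀ {m π} → π ↭ suc (suc m) ∷ down m → Avoids₃ (suc m ∷ π) →
                ∃ λ π′ → π ≡ suc (suc m) ∷ π′
second-is-top {π = []} π↭ _ = ⊥-elim (¬x∷xs↭[] (↭-sym π↭))
second-is-top {π = y ∷ π′} π↭ av with ∈-resp-↭ π↭ (here refl)
... | here refl = π′ , refl
... | there y∈ = ⊥-elim (smaller-then-larger av y<x ≤-refl
                   (∈-tail (∈-resp-↭ (↭-sym π↭) (here refl)) (>⇒≢ (m<n⇒m<1+n y<x))))
  where
  y<x = s≤s (∈-down⁻ y∈)

first-run : ∀ {n x π} → x ∷ π ↭ down (suc n) → Avoids₃ (x ∷ π) →
            x ≡ suc n ⊎ ∃₂ λ m π′ → n ≡ suc m × x ≡ suc m × π ≡ suc (suc m) ∷ π′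
first-run π↭ av with ∈-resp-↭ π↭ (here refl)
... | here refl = inj₁ refl
first-run {suc m} π↭ av | there (here refl)
  with π′ , refl ← second-is-top (drop-∷ (↭-trans π↭ (swap _ _ ↭-refl))) av =
  inj₂ (m , π′ , refl , refl , refl)
first-run {suc m} π↭ av | there (there x∈) =
  ⊥-elim (two-larger-after av x<m+1 ≤-refl
           (∈-tail (∈-resp-↭ (↭-sym π↭) (there (here refl))) (>⇒≢ x<m+1))
           (∈-tail (∈-resp-↭ (↭-sym π↭) (here refl)) (>⇒≢ (m<n⇒m<1+n x<m+1))))
  where
  x<m+1 = s≤s (∈-down⁻ x∈)

↭down-avoider⇒toPerm : ∀ n {π} → π ↭ down n → Avoids₃ π →
                        ∃ λ κ → total κ ≡ n × π ≡ toPerm κ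
↭down-avoider⇒toPerm zero π↭ _ = [] , refl , ↭-empty-inv π↭
↭down-avoider⇒toPerm (suc n) {[]} π↭ _ = ⊥-elim (¬x∷xs↭[] (↭-sym π↭))
↭down-avoider⇒toPerm (suc n) {x ∷ π} π↭ av with first-run π↭ av
... | inj₁ refl with ↭down-avoider⇒toPerm n (drop-∷ π↭) (avoids₃-tail av)
...   | κ , refl , refl = one ∷ κ , refl , refl
↭down-avoider⇒toPerm (suc n) {x ∷ π} π↭ av | inj₂ (m , π′ , refl , refl , refl)
  with ↭down-avoider⇒toPerm m (drop-∷ (drop-∷ (↭-trans π↭ (swap _ _ ↭-refl))))
         (avoids₃-tail (avoids₃-tail av))
... | κ , refl , refl = two ∷ κ , refl , refl

avoider⇒toPerm : ∀ {n π} → IsPerm n π → Avoids₃ π → ∃ λ κ → total κ ≡ n × π ≡ toPerm κ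
avoider⇒toPerm {n} isPerm = ↭down-avoider⇒toPerm n (↭-trans isPerm (↭-sym (down↭range1 n)))

toPerm-isPerm : ∀ κ → IsPerm (total κ) (toPerm κ)
toPerm-isPerm κ = ↭-trans (toPerm-↭ κ) (down↭range1 (total κ))

-- The partition of a composition

segment : ℕ → ℕ → List ℕ
segment o zero = []
segment o (suc n) = suc o ∷ segment (suc o) n

applyUpTo-segment : ∀ (f : ℕ → ℕ) o n → (∀ i → f i ≡ suc (o + i)) → applyUpTo f n ≡ segment o n
applyUpTo-segment f o zero _ = refl
applyUpTo-segment f o (suc n) f≗ =
  cong₂ _∷_ (trans (f≗ 0) (cong suc (+-identityʳ o)))
            (applyUpTo-segment (f ∘ suc) (suc o) n
               (λ i → trans (f≗ (suc i)) (cong suc (+-suc o i))))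

range1≡segment : ∀ n → range1 n ≡ segment 0 n
range1≡segment n = trans (map-upTo suc n) (applyUpTo-segment suc 0 n (λ _ → refl))

∈-segment⁻ : ∀ {x o n} → x ∈ segment o n → o < x
∈-segment⁻ {n = suc n} (here refl) = ≤-refl
∈-segment⁻ {n = suc n} (there x∈) = <-trans (n<1+n _) (∈-segment⁻ x∈)

toPartition : ℕ → List Step → List (List ℕ)
toPartition o [] = []
toPartition o (one ∷ κ) = (suc o ∷ []) ∷ toPartition (suc o) κ
toPartition o (two ∷ κ) = (suc o ∷ suc (suc o) ∷ []) ∷ toPartition (suc (suc o)) κ

length-toPartition : ∀ o κ → length (toPartition o κ) ≡ length κ
length-toPartition o [] = refl
length-toPartition o (one ∷ κ) = cong suc (length-toPartition (suc o) κ)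
length-toPartition o (two ∷ κ) = cong suc (length-toPartition (suc (suc o)) κ)

blockSizes-toPartition : ∀ o κ → blockSizes (toPartition o κ) ≡ sizes κ
blockSizes-toPartition o [] = refl
blockSizes-toPartition o (one ∷ κ) = cong (1 ∷_) (blockSizes-toPartition (suc o) κ)
blockSizes-toPartition o (two ∷ κ) = cong (2 ∷_) (blockSizes-toPartition (suc (suc o)) κ)

concat-toPartition : ∀ o κ → concat (toPartition o κ) ≡ segment o (total κ)
concat-toPartition o [] = refl
concat-toPartition o (one ∷ κ) = cong (suc o ∷_) (concat-toPartition (suc o) κ)
concat-toPartition o (two ∷ κ) =
  cong (λ l → suc o ∷ suc (suc o) ∷ l) (concat-toPartition (suc (suc o)) κ)

∈⇒≤maxL : ∀ {x l} → x ∈ l → x ≤ maxL l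
∈⇒≤maxL (here refl) = m≤m⊔n _ _
∈⇒≤maxL {l = y ∷ _} (there x∈) = ≤-trans (∈⇒≤maxL x∈) (m≤n⊔m y _)

toPartition-maxL : ∀ o κ → All (λ C → o < maxL C) (toPartition o κ)
toPartition-maxL o [] = []
toPartition-maxL o (one ∷ κ) =
  ∈⇒≤maxL {l = suc o ∷ []} (here refl) ∷
  All.map (<-trans (n<1+n o)) (toPartition-maxL (suc o) κ)
toPartition-maxL o (two ∷ κ) =
  ∈⇒≤maxL {l = suc o ∷ suc (suc o) ∷ []} (here refl) ∷
  All.map (<-trans (m<n⇒m<1+n (n<1+n o))) (toPartition-maxL (suc (suc o)) κ)

countBelow-all : ∀ {m} B → All (_< m) B → countBelow m B ≡ length B
countBelow-all [] _ = refl
countBelow-all (b ∷ B) (b<m ∷ B<m) rewrite <ᵇ-true b<m = cong suc (countBelow-all B B<m)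

rbWith-below : ∀ B Cs → All (λ C → All (_< maxL C) B) Cs → rbWith B Cs ≡ length B * length Cs
rbWith-below B [] _ = sym (*-zeroʳ (length B))
rbWith-below B (C ∷ Cs) (B<C ∷ B<Cs) =
  trans (cong₂ _+_ (countBelow-all B B<C) (rbWith-below B Cs B<Cs))
        (sym (*-suc (length B) (length Cs)))

rbWith-toPartition : ∀ {o} B κ → All (_≤ o) B → rbWith B (toPartition o κ) ≡ length B * length κ
rbWith-toPartition {o} B κ B≤o =
  trans (rbWith-below B (toPartition o κ)
          (All.map (λ o<C → All.map (λ b≤o → ≤-<-trans b≤o o<C) B≤o) (toPartition-maxL o κ)))
        (cong (length B *_) (length-toPartition o κ))

rb-toPartition : ∀ o κ → rb (toPartition o κ) ≡ laterPairs κ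
rb-toPartition o [] = refl
rb-toPartition o (one ∷ κ) =
  cong₂ _+_ (rbWith-toPartition _ κ (≤-refl ∷ [])) (rb-toPartition (suc o) κ)
rb-toPartition o (two ∷ κ) =
  cong₂ _+_ (rbWith-toPartition _ κ (n≤1+n _ ∷ ≤-refl ∷ [])) (rb-toPartition (suc (suc o)) κ)

IsPartitionOf : List ℕ → List (List ℕ) → Set
IsPartitionOf l β = All NonEmpty β × All (Linked _<_) β × Linked MinLt β × concat β ↭ l

minLt-cons : ∀ {x xs} o κ → x ≤ o → Linked MinLt (toPartition o κ) →
             Linked MinLt ((x ∷ xs) ∷ toPartition o κ)
minLt-cons o [] _ _ = [-]
minLt-cons o (one ∷ κ) x≤o mins = minLt (s≤s x≤o) ∷ mins
minLt-cons o (two ∷ κ) x≤o mins = minLt (s≤s x≤o) ∷ mins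

toPartition-isPartitionOf : ∀ o κ → IsPartitionOf (segment o (total κ)) (toPartition o κ)
toPartition-isPartitionOf o κ =
  nonEmptyBlocks o κ , increasing o κ , minLts o κ , ↭-reflexive (concat-toPartition o κ)
  where
  nonEmptyBlocks : ∀ o κ → All NonEmpty (toPartition o κ)
  nonEmptyBlocks o [] = []
  nonEmptyBlocks o (one ∷ κ) = nonEmpty ∷ nonEmptyBlocks (suc o) κ
  nonEmptyBlocks o (two ∷ κ) = nonEmpty ∷ nonEmptyBlocks (suc (suc o)) κ
  increasing : ∀ o κ → All (Linked _<_) (toPartition o κ)
  increasing o [] = []
  increasing o (one ∷ κ) = [-] ∷ increasing (suc o) κ
  increasing o (two ∷ κ) = (≤-refl ∷ [-]) ∷ increasing (suc (suc o)) κ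
  minLts : ∀ o κ → Linked MinLt (toPartition o κ)
  minLts o [] = []
  minLts o (one ∷ κ) = minLt-cons (suc o) κ ≤-refl (minLts (suc o) κ)
  minLts o (two ∷ κ) = minLt-cons (suc (suc o)) κ (n≤1+n _) (minLts (suc (suc o)) κ)

data ShortInterval : List ℕ → Set where
  single : ∀ x → ShortInterval (x ∷ [])
  pair   : ∀ x → ShortInterval (x ∷ suc x ∷ [])

no-gap : ∀ {B a b d} → ShortInterval B → a ∈ B → d ∈ B → a < b → b < d → ⊥
no-gap (single _) (here refl) (here refl) a<b b<d = <-asym a<b b<d
no-gap (pair _) (here refl) (here refl) a<b b<d = <-asym a<b b<d
no-gap (pair _) (here refl) (there (here refl)) a<b b<d = ≤⇒≯ a<b b<d
no-gap (pair _) (there (here refl)) (here refl) a<b b<d = <-asym (<-trans a<b b<d) ≤-refl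
no-gap (pair _) (there (here refl)) (there (here refl)) a<b b<d = <-asym a<b b<d

toPartition-shortIntervals : ∀ o κ → All ShortInterval (toPartition o κ)
toPartition-shortIntervals o [] = []
toPartition-shortIntervals o (one ∷ κ) = single _ ∷ toPartition-shortIntervals (suc o) κ
toPartition-shortIntervals o (two ∷ κ) = pair _ ∷ toPartition-shortIntervals (suc (suc o)) κ

toPartition-avoids13/2 : ∀ o κ → Avoids (toPartition o κ) pat13/2
toPartition-avoids13/2 o κ (_ , g , ord , _ , mem) =
  no-gap (All.lookup (toPartition-shortIntervals o κ) (∈-lookup (g zero)))
         (mem zero 1 (here refl)) (mem zero 3 (there (here refl)))
         (ord 1 2 (here refl) (there (there (here refl))) 1<2)
         (ord 2 3 (there (there (here refl))) (there (here refl)) 2<3)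

toPartition-avoids123 : ∀ o κ → Avoids (toPartition o κ) pat123
toPartition-avoids123 o κ (_ , g , ord , _ , mem) =
  no-gap (All.lookup (toPartition-shortIntervals o κ) (∈-lookup (g zero)))
         (mem zero 1 (here refl)) (mem zero 3 (there (there (here refl))))
         (ord 1 2 (here refl) (there (here refl)) 1<2)
         (ord 2 3 (there (here refl)) (there (there (here refl))) 2<3)

triple : ℕ → ℕ → ℕ → ℕ → ℕ
triple x y z 1 = x
triple x y z 2 = y
triple x y z _ = z

triple-mono : ∀ {x y z} → x < y → y < z →
              ∀ {a b} → 1 ≤ a → a < b → b ≤ 3 → triple x y z a < triple x y z b
triple-mono x<y y<z {1} {2} _ _ _ = x<y
triple-mono x<y y<z {1} {3} _ _ _ = <-trans x<y y<z
triple-mono x<y y<z {2} {3} _ _ _ = y<z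
triple-mono x<y y<z {1} {suc (suc (suc (suc _)))} _ _ (s≤s (s≤s (s≤s ())))
triple-mono x<y y<z {2} {suc (suc (suc (suc _)))} _ _ (s≤s (s≤s (s≤s ())))
triple-mono x<y y<z {1} {1} _ (s≤s ()) _
triple-mono x<y y<z {2} {2} _ (s≤s (s≤s ())) _
triple-mono x<y y<z {2} {1} _ (s≤s ()) _
triple-mono x<y y<z {suc (suc (suc a))} {b} _ a<b b≤3 =
  contradiction (<-≤-trans a<b b≤3) (≤⇒≯ (s≤s (s≤s (s≤s z≤n))))

OneToThree : List ℕ → Set
OneToThree = All (λ a → 1 ≤ a × a ≤ 3)

triple-embeds : ∀ {x y z l} → x < y → y < z → OneToThree l →
                ∀ a b → a ∈ l → b ∈ l → a < b → triple x y z a < triple x y z b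
triple-embeds x<y y<z bounds a b a∈ b∈ a<b =
  triple-mono x<y y<z (proj₁ (All.lookup bounds a∈)) a<b (proj₂ (All.lookup bounds b∈))

contains-13/2 : ∀ {B Bs x y z} → x < y → y < z → x ∈ B → z ∈ B → Any (y ∈_) Bs →
                Contains (B ∷ Bs) pat13/2
contains-13/2 {B} {Bs} {x} {y} {z} x<y y<z x∈B z∈B y∈Bs =
  triple x y z , block , triple-embeds x<y y<z ground , block-injective , embed
  where
  ground : OneToThree (concat pat13/2)
  ground = (≤-refl , s≤s z≤n) ∷ (s≤s z≤n , ≤-refl) ∷ (s≤s z≤n , s≤s (s≤s z≤n)) ∷ []
  block : Fin 2 → Fin (length (B ∷ Bs))
  block zero = zero
  block (suc _) = suc (index y∈Bs)
  block-injective : ∀ {i j} → block i ≡ block j → i ≡ j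
  block-injective {zero} {zero} _ = refl
  block-injective {suc zero} {suc zero} _ = refl
  embed : ∀ j a → a ∈ lookup pat13/2 j → triple x y z a ∈ lookup (B ∷ Bs) (block j)
  embed zero _ (here refl) = x∈B
  embed zero _ (there (here refl)) = z∈B
  embed (suc zero) _ (here refl) = lookup-index y∈Bs

contains-123 : ∀ {B Bs x y z} → x < y → y < z → x ∈ B → y ∈ B → z ∈ B → Contains (B ∷ Bs) pat123
contains-123 {B} {Bs} {x} {y} {z} x<y y<z x∈B y∈B z∈B =
  triple x y z , block , triple-embeds x<y y<z ground , block-injective , embed
  where
  ground : OneToThree (concat pat123)
  ground = (≤-refl , s≤s z≤n) ∷ (s≤s z≤n , s≤s (s≤s z≤n)) ∷ (s≤s z≤n , ≤-refl) ∷ []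
  block : Fin 1 → Fin (length (B ∷ Bs))
  block _ = zero
  block-injective : ∀ {i j} → block i ≡ block j → i ≡ j
  block-injective {zero} {zero} _ = refl
  embed : ∀ j a → a ∈ lookup pat123 j → triple x y z a ∈ lookup (B ∷ Bs) (block j)
  embed zero _ (here refl) = x∈B
  embed zero _ (there (here refl)) = y∈B
  embed zero _ (there (there (here refl))) = z∈B

avoids-tail-partition : ∀ {B Bs α} → Avoids (B ∷ Bs) α → Avoids Bs α
avoids-tail-partition av (f , g , ord , g-injective , mem) =
  av (f , suc ∘ g , ord , g-injective ∘ Finₚ.suc-injective , mem)

drop-prefix : ∀ (B : List ℕ) {l l′} → B ++ l ↭ B ++ l′ → l ↭ l′
drop-prefix [] l↭ = l↭
drop-prefix (b ∷ B) l↭ = drop-prefix B (drop-∷ l↭)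

partition-tail : ∀ {B Bs l} → IsPartitionOf (B ++ l) (B ∷ Bs) → IsPartitionOf l Bs
partition-tail {B} (_ ∷ nonEmpties , _ ∷ increasings , mins , β↭) =
  nonEmpties , increasings , Linked.tail mins , drop-prefix B β↭

linked-head-< : ∀ {c x : ℕ} {cs} → Linked _<_ (c ∷ cs) → x ∈ cs → c < x
linked-head-< (c<d ∷ _) (here refl) = c<d
linked-head-< (c<d ∷ ds↗) (there x∈) = <-trans c<d (linked-head-< ds↗ x∈)

later-blocks-above : ∀ {a x as} Bs → Linked MinLt ((a ∷ as) ∷ Bs) → All (Linked _<_) Bs →
                     x ∈ concat Bs → a < x
later-blocks-above ((c ∷ cs) ∷ Cs) (minLt a<c ∷ mins) (c↗ ∷ Cs↗) x∈ with ∈-++⁻ (c ∷ cs) x∈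
... | inj₁ (here refl) = a<c
... | inj₁ (there x∈cs) = <-trans a<c (linked-head-< c↗ x∈cs)
... | inj₂ x∈Cs = <-trans a<c (later-blocks-above Cs mins Cs↗ x∈Cs)

partition-head-least : ∀ {a x as Bs l} → IsPartitionOf l ((a ∷ as) ∷ Bs) → x ∈ l → a ≤ x
partition-head-least {a} {as = as} {Bs} (_ , a↗ ∷ Bs↗ , mins , β↭) x∈
  with ∈-++⁻ (a ∷ as) (∈-resp-↭ (↭-sym β↭) x∈)
... | inj₁ (here refl) = ≤-refl
... | inj₁ (there x∈as) = <⇒≤ (linked-head-< a↗ x∈as)
... | inj₂ x∈Bs = <⇒≤ (later-blocks-above Bs mins Bs↗ x∈Bs)

partition-head : ∀ {a as Bs o n} → IsPartitionOf (segment o (suc n)) ((a ∷ as) ∷ Bs) → a ≡ suc o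
partition-head part@(_ , _ , _ , β↭) =
  ≤-antisym (partition-head-least part (here refl)) (∈-segment⁻ (∈-resp-↭ β↭ (here refl)))

Avoids₂ : List (List ℕ) → Set
Avoids₂ β = Avoids β pat13/2 × Avoids β pat123

avoids₂-tail : ∀ {B Bs} → Avoids₂ (B ∷ Bs) → Avoids₂ Bs
avoids₂-tail (av13/2 , av123) = avoids-tail-partition av13/2 , avoids-tail-partition av123

first-block : ∀ {o n B Bs} → IsPartitionOf (segment o (suc n)) (B ∷ Bs) → Avoids₂ (B ∷ Bs) →
              B ≡ suc o ∷ [] ⊎ ∃ λ m → n ≡ suc m × B ≡ suc o ∷ suc (suc o) ∷ []
first-block {B = []} (() ∷ _ , _) _
first-block {B = a ∷ as} part _ with partition-head part
first-block {B = _ ∷ []} _ _ | refl = inj₁ refl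
first-block {n = zero} {B = _ ∷ _ ∷ []} (_ , _ , _ , β↭) _ | refl = ⊥-elim (¬x∷xs↭[] (drop-∷ β↭))
first-block {o} {suc m} {_ ∷ b ∷ []} {Bs} (_ , (o<b ∷ _) ∷ _ , _ , β↭) (av13/2 , _) | refl
  with m≤n⇒m<n∨m≡n o<b
... | inj₂ refl = inj₂ (m , refl , refl)
... | inj₁ o+1<b =
  ⊥-elim (av13/2 (contains-13/2 ≤-refl o+1<b (here refl) (there (here refl)) (∈-concat⁻ Bs o+1∈Bs)))
  where
  o+1∈Bs : suc (suc o) ∈ concat Bs
  o+1∈Bs = ∈-tail (∈-tail (∈-resp-↭ (↭-sym β↭) (there (here refl))) (>⇒≢ (n<1+n _))) (<⇒≢ o+1<b)
first-block {B = _ ∷ b ∷ d ∷ _} (_ , (o<b ∷ b<d ∷ _) ∷ _ , _) (_ , av123) | refl =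
  ⊥-elim (av123 (contains-123 o<b b<d (here refl) (there (here refl)) (there (there (here refl)))))

segment-avoider⇒toPartition : ∀ n o {β} → IsPartitionOf (segment o n) β → Avoids₂ β →
                               ∃ λ κ → total κ ≡ n × β ≡ toPartition o κ
segment-avoider⇒toPartition zero o {[]} _ _ = [] , refl , refl
segment-avoider⇒toPartition zero o {[] ∷ _} (() ∷ _ , _) _
segment-avoider⇒toPartition zero o {(_ ∷ _) ∷ _} (_ , _ , _ , β↭) _ = ⊥-elim (¬x∷xs↭[] β↭)
segment-avoider⇒toPartition (suc n) o {[]} (_ , _ , _ , β↭) _ = ⊥-elim (¬x∷xs↭[] (↭-sym β↭))
segment-avoider⇒toPartition (suc n) o {B ∷ Bs} part av with first-block part av
... | inj₁ refl with segment-avoider⇒toPartition n (suc o) (partition-tail part) (avoids₂-tail av)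
...   | κ , refl , refl = one ∷ κ , refl , refl
segment-avoider⇒toPartition (suc n) o {B ∷ Bs} part av | inj₂ (m , refl , refl)
  with segment-avoider⇒toPartition m (suc (suc o)) (partition-tail part) (avoids₂-tail av)
... | κ , refl , refl = two ∷ κ , refl , refl

IsPartitionOf-resp-↭ : ∀ {l l′ β} → l ↭ l′ → IsPartitionOf l β → IsPartitionOf l′ β
IsPartitionOf-resp-↭ l↭ (nonEmpties , increasings , mins , β↭) =
  nonEmpties , increasings , mins , ↭-trans β↭ l↭

avoider⇒toPartition : ∀ {n β} → IsSetPartition n β → Avoids₂ β →
                      ∃ λ κ → total κ ≡ n × β ≡ toPartition 0 κ
avoider⇒toPartition {n} part =
  segment-avoider⇒toPartition n 0 (IsPartitionOf-resp-↭ (↭-reflexive (range1≡segment n)) part)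

toPartition-isSetPartition : ∀ κ → IsSetPartition (total κ) (toPartition 0 κ)
toPartition-isSetPartition κ =
  IsPartitionOf-resp-↭ (↭-reflexive (sym (range1≡segment (total κ))))
                       (toPartition-isPartitionOf 0 κ)

-- The bijection

↔-Refinement : ∀ {A B : Set} {P : A → Set} {Q : B → Set} →
               DecidableEquality A → DecidableEquality B →
               (f : A → B) (g : B → A) →
               (∀ {x} → P x → Q (f x)) → (∀ {y} → Q y → P (g y)) →
               (∀ {x} → P x → g (f x) ≡ x) → (∀ {y} → Q y → f (g y) ≡ y) →
               Refinement A P ↔ Refinement B Q
↔-Refinement _≟A_ _≟B_ f g P⇒Q Q⇒P gf≡ fg≡ =
  mk↔ₛ′ (Refinement.map f P⇒Q) (Refinement.map g Q⇒P) inverseˡ inverseʳ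
  where
  -- The witnesses are irrelevant; the round-trip equations are rebuilt from
  -- them by recomputing a decision of equality.
  inverseˡ : ∀ y → Refinement.map f P⇒Q (Refinement.map g Q⇒P y) ≡ y
  inverseˡ (y , [ q ]) = value-injective (recompute (f (g y) ≟B y) (fg≡ q))
  inverseʳ : ∀ x → Refinement.map g Q⇒P (Refinement.map f P⇒Q x) ≡ x
  inverseʳ (x , [ p ]) = value-injective (recompute (g (f x) ≟A x) (gf≡ p))

permToPartition : List ℕ → List (List ℕ)
permToPartition π = toPartition 0 (fromSizes (runLengths π))

partitionToPerm : List (List ℕ) → List ℕ
partitionToPerm β = toPerm (fromSizes (blockSizes β))

permToPartition-toPerm : ∀ κ → permToPartition (toPerm κ) ≡ toPartition 0 κ
permToPartition-toPerm κ =
  cong (toPartition 0) (trans (cong fromSizes (runLengths-toPerm κ)) (fromSizes-sizes κ))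

partitionToPerm-toPartition : ∀ κ → partitionToPerm (toPartition 0 κ) ≡ toPerm κ
partitionToPerm-toPartition κ =
  cong toPerm (trans (cong fromSizes (blockSizes-toPartition 0 κ)) (fromSizes-sizes κ))

blockSizes≡runLengths : ∀ κ → blockSizes (toPartition 0 κ) ≡ runLengths (toPerm κ)
blockSizes≡runLengths κ = trans (blockSizes-toPartition 0 κ) (sym (runLengths-toPerm κ))

rb≡maj : ∀ κ → rb (toPartition 0 κ) ≡ maj (toPerm κ)
rb≡maj κ = trans (rb-toPartition 0 κ) (sym (maj-toPerm κ))

PermProperties : ℕ → ℕ → ℕ → ℕ → List ℕ → Set
PermProperties n a b c π =
  IsPerm n π × PAvoids π p123 × PAvoids π p132 × PAvoids π p213 ×
  sPerm π ≡ a × dPerm π ≡ b × maj π ≡ c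

PartitionProperties : ℕ → ℕ → ℕ → ℕ → List (List ℕ) → Set
PartitionProperties n a b c β =
  IsSetPartition n β × Avoids β pat13/2 × Avoids β pat123 ×
  sPart β ≡ a × dPart β ≡ b × rb β ≡ c

permToPartition-properties : ∀ {n a b c π} → PermProperties n a b c π →
                             PartitionProperties n a b c (permToPartition π)
permToPartition-properties (isPerm , av123 , av132 , av213 , refl , refl , refl)
  with avoider⇒toPerm isPerm (av123 , av132 , av213)
... | κ , refl , refl rewrite permToPartition-toPerm κ =
  toPartition-isSetPartition κ , toPartition-avoids13/2 0 κ , toPartition-avoids123 0 κ ,
  cong (countEq 1) (blockSizes≡runLengths κ) , cong (countEq 2) (blockSizes≡runLengths κ) , rb≡maj κ

partitionToPerm-properties : ∀ {n a b c β} → PartitionProperties n a b c β →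
                             PermProperties n a b c (partitionToPerm β)
partitionToPerm-properties (isPartition , av13/2 , av123 , refl , refl , refl)
  with avoider⇒toPartition isPartition (av13/2 , av123)
... | κ , refl , refl rewrite partitionToPerm-toPartition κ =
  let av123′ , av132′ , av213′ = toPerm-avoids κ in
  toPerm-isPerm κ , av123′ , av132′ , av213′ ,
  cong (countEq 1) (sym (blockSizes≡runLengths κ)) ,
  cong (countEq 2) (sym (blockSizes≡runLengths κ)) , sym (rb≡maj κ)

partitionToPerm-permToPartition : ∀ {n π} → IsPerm n π → Avoids₃ π →
                                  partitionToPerm (permToPartition π) ≡ π
partitionToPerm-permToPartition isPerm av with avoider⇒toPerm isPerm av
... | κ , refl , refl =
  trans (cong partitionToPerm (permToPartition-toPerm κ)) (partitionToPerm-toPartition κ)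

permToPartition-partitionToPerm : ∀ {n β} → IsSetPartition n β → Avoids₂ β →
                                  permToPartition (partitionToPerm β) ≡ β
permToPartition-partitionToPerm isPartition av with avoider⇒toPartition isPartition av
... | κ , refl , refl =
  trans (cong permToPartition (partitionToPerm-toPartition κ)) (permToPartition-toPerm κ)

theorem3p1 : (n a b c : ℕ) → PermFiber n a b c ↔ PartFiber n a b c
theorem3p1 n a b c =
  ↔-Refinement (≡-dec _≟_) (≡-dec (≡-dec _≟_)) permToPartition partitionToPerm
    permToPartition-properties partitionToPerm-properties
    (λ (isPerm , av123 , av132 , av213 , _) →
       partitionToPerm-permToPartition isPerm (av123 , av132 , av213))
    (λ (isPartition , av13/2 , av123 , _) →
       permToPartition-partitionToPerm isPartition (av13/2 , av123))
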